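{- Let $\pi$ be a sum indecomposable permutation of length $n$. (a) If $\pi$ has at least one entry to the left of the entry $n$, then there is an entry $x$ to the left of $n$ such that $\pi-x$ is sum indecomposable. (b) If $\pi$ has at least two entries to the right of the entry $n$, then there is an entry $x$ to the right of $n$ such that $\pi-x$ is sum indecomposable.
   Context: Permutations are in one-line notation; "the entry $n$" is the entry with value $n$ (the maximum). A nonempty permutation is sum indecomposable if it is not of the form $\alpha\oplus\beta$ with $\alpha,\beta$ nonempty, where $(\alpha\oplus\beta)(i)=\alpha(i)$ for $i\le|\alpha|$ and $\beta(i-|\alpha|)+|\alpha|$ otherwise. For an entry $x$ of $\pi$, $\pi-x$ is the permutation order isomorphic to $\pi$ with $x$ deleted. -}

module Defs where

open import Data.Nat using (ℕ; zero; suc; _+_)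
open import Data.Fin using (Fin; fromℕ; _<_; _↑ˡ_; _↑ʳ_; splitAt; cast)
open import Data.Fin.Permutation using (Permutation′; _⟨$⟩ʳ_; _⟨$⟩ˡ_; remove)
open import Data.Sum using (inj₁; inj₂)
open import Data.Product using (Σ; ∃; _×_; _,_)
open import Relation.Binary.PropositionalEquality using (_≡_)
open import Relation.Nullary using (¬_)

-- A permutation of length n is a bijection Fin n ↔ Fin n; position i
-- (0-based, left to right) carries the value π ⟨$⟩ʳ i (values 0..n-1, so
-- the maximum entry "n" is the value fromℕ (n-1)).

_⊕_ : ∀ {a b} → Permutation′ a → Permutation′ b → Fin (a + b) → Fin (a + b)
_⊕_ {a} {b} α β i with splitAt a i
... | inj₁ j = (α ⟨$⟩ʳ j) ↑ˡ b
... | inj₂ j = a ↑ʳ (β ⟨$⟩ʳ j)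

SumDecomposable : ∀ {n} → Permutation′ n → Set
SumDecomposable {n} π =
  Σ ℕ λ a → Σ ℕ λ b → Σ (suc a + suc b ≡ n) λ e →
  Σ (Permutation′ (suc a)) λ α → Σ (Permutation′ (suc b)) λ β →
  ∀ (i : Fin (suc a + suc b)) → π ⟨$⟩ʳ (cast e i) ≡ cast e ((α ⊕ β) i)

SumIndecomposable : ∀ {n} → Permutation′ n → Set
SumIndecomposable {zero} π = Data.Empty.⊥
  where import Data.Empty
SumIndecomposable {suc n} π = ¬ SumDecomposable π

posMax : ∀ {m} → Permutation′ (suc m) → Fin (suc m)
posMax {m} π = π ⟨$⟩ˡ fromℕ m

-- π - x, where x is the entry at position i: Data.Fin.Permutation.remove
-- deletes position i and standardizes (order-isomorphically, via punchIn/punchOut).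
deleteAt : ∀ {m} → Fin (suc m) → Permutation′ (suc m) → Permutation′ m
deleteAt = remove

-- Positions and values are 0-based, so n is the value m of a permutation of length m + 1.
-- A permutation of length n is sum decomposable exactly when, for some 0 < k < n, it maps
-- its first k positions into its first k values (a block k).  Suppose σ = π - x, with x at
-- position i, has a block k.
-- (a) Take i leftmost with π(i) ≤ i + 1, or just before n if that position lies further
-- right.  If k ≤ i, the entry at position k - 1 has π(k - 1) ≤ k, contradicting the choice
-- of i.  If i < k, either π(i) ≤ i + 1 ≤ k and π itself has the block k + 1, or n stands at
-- position i + 1 ≤ k and cannot lie in the block.
-- (b) Take x the larger of two entries right of n.  The block of σ lies left of n.  If
-- π(i) ≥ k it is a block of π; otherwise the first k positions and the two chosen entries
-- are k + 2 positions of π with values at most k.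
module Submission where

open import Defs
open import Data.Nat using (ℕ; suc)
open import Data.Fin using (Fin; _<_)
open import Data.Fin.Permutation using (Permutation′)
open import Data.Product using (Σ; _×_)

open import Data.Empty using (⊥)
open import Data.Fin.Base
  using (zero; suc; toℕ; fromℕ; fromℕ<; inject≤; inject; Fin′; pred; punchIn;
         splitAt; _↑ˡ_; _↑ʳ_; reduce≥)
open import Data.Fin.Properties
  using (_≟_; toℕ-injective; toℕ<n; toℕ-fromℕ; toℕ-fromℕ<; toℕ-inject; toℕ-inject₁; toℕ-inject≤;
         inject≤-injective; injective⇒≤; ¬∀⟶∃¬-smallest; toℕ-↑ˡ; toℕ-↑ʳ; ↑ˡ-injective; ↑ʳ-injective;
         splitAt-<; splitAt-≥; splitAt-↑ˡ; splitAt-↑ʳ; splitAt⁻¹-↑ˡ; splitAt⁻¹-↑ʳ; cast-is-id)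
open import Data.Fin.Permutation
  using (_⟨$⟩ʳ_; _⟨$⟩ˡ_; permutation; inverseˡ; inverseʳ; remove; punchIn-permute)
open import Data.Nat.Base as ℕ using (zero; z≤n; s≤s; z<s; s<s)
import Data.Nat.Properties as ℕ
open import Data.Product using (∃; _,_; proj₁; proj₂)
open import Data.Sum using (_⊎_; inj₁; inj₂; [_,_]′)
open import Data.Vec.Functional using (_∷_)
open import Function using (_∘_; Injective)
open import Relation.Binary.Definitions using (tri<; tri≈; tri>)
open import Relation.Binary.PropositionalEquality
open import Relation.Nullary using (¬_; yes; no; contradiction)

private
  variable
    a k m n : ℕ

⟨$⟩ʳ-injective : (π : Permutation′ n) → Injective _≡_ _≡_ (π ⟨$⟩ʳ_)
⟨$⟩ʳ-injective π {x} {y} πx≡πy = begin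
  x                  ≡⟨ inverseˡ π ⟨
  π ⟨$⟩ˡ (π ⟨$⟩ʳ x)  ≡⟨ cong (π ⟨$⟩ˡ_) πx≡πy ⟩
  π ⟨$⟩ˡ (π ⟨$⟩ʳ y)  ≡⟨ inverseˡ π ⟩
  y                  ∎
  where open ≡-Reasoning

∷-injective : ∀ {x} {h : Fin a → Fin n} → Injective _≡_ _≡_ h → (∀ t → h t ≢ x) →
              Injective _≡_ _≡_ (x ∷ h)
∷-injective h-inj x∉h {zero}  {zero}  _  = refl
∷-injective h-inj x∉h {zero}  {suc u} eq = contradiction (sym eq) (x∉h u)
∷-injective h-inj x∉h {suc t} {zero}  eq = contradiction eq (x∉h t)
∷-injective h-inj x∉h {suc t} {suc u} eq = cong suc (h-inj eq)

bounded-injective⇒≤ : ∀ {b} (h : Fin a → Fin n) → Injective _≡_ _≡_ h →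
                      (∀ t → toℕ (h t) ℕ.< b) → a ℕ.≤ b
bounded-injective⇒≤ h h-inj h<b = injective⇒≤ λ {t} {u} eq → h-inj (toℕ-injective (begin
  toℕ (h t)             ≡⟨ toℕ-fromℕ< (h<b t) ⟨
  toℕ (fromℕ< (h<b t))  ≡⟨ cong toℕ eq ⟩
  toℕ (fromℕ< (h<b u))  ≡⟨ toℕ-fromℕ< (h<b u) ⟩
  toℕ (h u)             ∎))
  where open ≡-Reasoning

module _ .(k≤n : k ℕ.≤ n) where

  inject≤-< : (t : Fin k) → toℕ (inject≤ t k≤n) ℕ.< k
  inject≤-< t = subst (ℕ._< k) (sym (toℕ-inject≤ t k≤n)) (toℕ<n t)

  inject≤-≢ : ∀ {j} → k ℕ.≤ toℕ j → (t : Fin k) → inject≤ t k≤n ≢ j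
  inject≤-≢ k≤j t refl = ℕ.<⇒≱ (inject≤-< t) k≤j

PrefixClosed : (Fin n → Fin n) → ℕ → Set
PrefixClosed f k = ∀ j → toℕ j ℕ.< k → toℕ (f j) ℕ.< k

SuffixClosed : (Fin n → Fin n) → ℕ → Set
SuffixClosed f k = ∀ j → k ℕ.≤ toℕ j → k ℕ.≤ toℕ (f j)

prefixClosed-inverse : (π : Permutation′ n) → PrefixClosed (π ⟨$⟩ʳ_) k → PrefixClosed (π ⟨$⟩ˡ_) k
prefixClosed-inverse {n} {k} π closed w w<k with toℕ (π ⟨$⟩ˡ w) ℕ.<? k
... | yes v<k = v<k
... | no  v≮k = contradiction (bounded-injective⇒≤ ((π ⟨$⟩ʳ_) ∘ h) h-inj bound) ℕ.1+n≰n
  where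
  -- π⁻¹ w and the first k positions would be k + 1 positions sent below k.
  k≤v : k ℕ.≤ toℕ (π ⟨$⟩ˡ w)
  k≤v = ℕ.≮⇒≥ v≮k
  k≤n : k ℕ.≤ n
  k≤n = ℕ.≤-trans k≤v (ℕ.<⇒≤ (toℕ<n _))
  h : Fin (suc k) → Fin n
  h = (π ⟨$⟩ˡ w) ∷ λ t → inject≤ t k≤n
  h-inj : Injective _≡_ _≡_ ((π ⟨$⟩ʳ_) ∘ h)
  h-inj = ∷-injective (inject≤-injective _ _ _ _) (inject≤-≢ k≤n k≤v) ∘ ⟨$⟩ʳ-injective π
  bound : ∀ t → toℕ (π ⟨$⟩ʳ h t) ℕ.< k
  bound zero    = subst (λ x → toℕ x ℕ.< k) (sym (inverseʳ π)) w<k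
  bound (suc t) = closed _ (inject≤-< k≤n t)

prefixClosed⇒suffixClosed : ∀ {f g : Fin n → Fin n} → (∀ j → g (f j) ≡ j) →
                            PrefixClosed g k → SuffixClosed f k
prefixClosed⇒suffixClosed {k = k} {f} g∘f≗id closed j k≤j = ℕ.≮⇒≥ λ fj<k →
  ℕ.<⇒≱ (subst (λ x → toℕ x ℕ.< k) (g∘f≗id j) (closed (f j) fj<k)) k≤j

RestrictsAlong : (Fin a → Fin n) → (Fin n → Fin n) → Set
RestrictsAlong ι f = ∀ t → ∃ λ s → f (ι t) ≡ ι s

module _ {ι : Fin a → Fin n} (ι-injective : Injective _≡_ _≡_ ι) (π : Permutation′ n)
         (πʳ : RestrictsAlong ι (π ⟨$⟩ʳ_)) (πˡ : RestrictsAlong ι (π ⟨$⟩ˡ_)) where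

  restrict : Permutation′ a
  restrict = permutation (proj₁ ∘ πʳ) (proj₁ ∘ πˡ)
    (restrict-inverse {π ⟨$⟩ʳ_} πʳ πˡ (inverseʳ π)) (restrict-inverse {π ⟨$⟩ˡ_} πˡ πʳ (inverseˡ π))
    where
    restrict-inverse : ∀ {f g} (F : RestrictsAlong ι f) (G : RestrictsAlong ι g) →
                       (∀ {x} → f (g x) ≡ x) → ∀ t → proj₁ (F (proj₁ (G t))) ≡ t
    restrict-inverse {f} {g} F G f∘g≗id t = ι-injective (begin
      ι (proj₁ (F (proj₁ (G t))))  ≡⟨ proj₂ (F _) ⟨
      f (ι (proj₁ (G t)))          ≡⟨ cong f (proj₂ (G t)) ⟨
      f (g (ι t))                  ≡⟨ f∘g≗id ⟩
      ι t                          ∎)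
      where open ≡-Reasoning

  restrict-commutes : ∀ t → ι (restrict ⟨$⟩ʳ t) ≡ π ⟨$⟩ʳ ι t
  restrict-commutes t = sym (proj₂ (πʳ t))

toℕ<⇒↑ˡ : (x : Fin (k ℕ.+ m)) → toℕ x ℕ.< k → ∃ λ s → x ≡ s ↑ˡ m
toℕ<⇒↑ˡ {k} x x<k = fromℕ< x<k , sym (splitAt⁻¹-↑ˡ (splitAt-< k x x<k))

toℕ≥⇒↑ʳ : (x : Fin (k ℕ.+ m)) → k ℕ.≤ toℕ x → ∃ λ s → x ≡ k ↑ʳ s
toℕ≥⇒↑ʳ {k} x k≤x = reduce≥ x k≤x , sym (splitAt⁻¹-↑ʳ (splitAt-≥ k x k≤x))

↑-view : (i : Fin (k ℕ.+ m)) → (∃ λ t → i ≡ t ↑ˡ m) ⊎ (∃ λ t → i ≡ k ↑ʳ t)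
↑-view {k} i with splitAt k i in eq
... | inj₁ t = inj₁ (t , sym (splitAt⁻¹-↑ˡ eq))
... | inj₂ t = inj₂ (t , sym (splitAt⁻¹-↑ʳ eq))

prefixClosed⇒restrictsAlong-↑ˡ : {f : Fin (k ℕ.+ m) → Fin (k ℕ.+ m)} → PrefixClosed f k →
                                  RestrictsAlong (_↑ˡ m) f
prefixClosed⇒restrictsAlong-↑ˡ {k} {m} {f} closed t =
  toℕ<⇒↑ˡ (f (t ↑ˡ m)) (closed _ (subst (ℕ._< k) (sym (toℕ-↑ˡ t m)) (toℕ<n t)))

suffixClosed⇒restrictsAlong-↑ʳ : {f : Fin (k ℕ.+ m) → Fin (k ℕ.+ m)} → SuffixClosed f k →
                                  RestrictsAlong (k ↑ʳ_) f
suffixClosed⇒restrictsAlong-↑ʳ {k} {m} {f} closed t =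
  toℕ≥⇒↑ʳ (f (k ↑ʳ t)) (closed _ (subst (k ℕ.≤_) (sym (toℕ-↑ʳ k t)) (ℕ.m≤m+n k (toℕ t))))

⊕-↑ˡ : ∀ {b} (α : Permutation′ a) (β : Permutation′ b) t → (α ⊕ β) (t ↑ˡ b) ≡ (α ⟨$⟩ʳ t) ↑ˡ b
⊕-↑ˡ {a} {b} α β t rewrite splitAt-↑ˡ a t b = refl

⊕-↑ʳ : ∀ {b} (α : Permutation′ a) (β : Permutation′ b) t → (α ⊕ β) (a ↑ʳ t) ≡ a ↑ʳ (β ⟨$⟩ʳ t)
⊕-↑ʳ {a} {b} α β t rewrite splitAt-↑ʳ a b t = refl

prefixClosed⇒⊕ : (π : Permutation′ (k ℕ.+ m)) → PrefixClosed (π ⟨$⟩ʳ_) k →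
                 Σ (Permutation′ k) λ α → Σ (Permutation′ m) λ β → ∀ i → π ⟨$⟩ʳ i ≡ (α ⊕ β) i
prefixClosed⇒⊕ {k} {m} π closed = α , β , π≗α⊕β
  where
  closed⁻¹ : PrefixClosed (π ⟨$⟩ˡ_) k
  closed⁻¹ = prefixClosed-inverse π closed
  πʳ-left : RestrictsAlong (_↑ˡ m) (π ⟨$⟩ʳ_)
  πʳ-left = prefixClosed⇒restrictsAlong-↑ˡ closed
  πˡ-left : RestrictsAlong (_↑ˡ m) (π ⟨$⟩ˡ_)
  πˡ-left = prefixClosed⇒restrictsAlong-↑ˡ closed⁻¹
  πʳ-right : RestrictsAlong (k ↑ʳ_) (π ⟨$⟩ʳ_)
  πʳ-right = suffixClosed⇒restrictsAlong-↑ʳ (prefixClosed⇒suffixClosed (λ _ → inverseˡ π) closed⁻¹)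
  πˡ-right : RestrictsAlong (k ↑ʳ_) (π ⟨$⟩ˡ_)
  πˡ-right = suffixClosed⇒restrictsAlong-↑ʳ (prefixClosed⇒suffixClosed (λ _ → inverseʳ π) closed)
  α : Permutation′ k
  α = restrict (↑ˡ-injective m _ _) π πʳ-left πˡ-left
  β : Permutation′ m
  β = restrict (↑ʳ-injective k _ _) π πʳ-right πˡ-right
  π≗α⊕β : ∀ i → π ⟨$⟩ʳ i ≡ (α ⊕ β) i
  π≗α⊕β i with ↑-view {k} {m} i
  ... | inj₁ (t , refl) =
    trans (sym (restrict-commutes (↑ˡ-injective m _ _) π πʳ-left πˡ-left t)) (sym (⊕-↑ˡ α β t))
  ... | inj₂ (t , refl) =
    trans (sym (restrict-commutes (↑ʳ-injective k _ _) π πʳ-right πˡ-right t)) (sym (⊕-↑ʳ α β t))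

⊕⇒prefixClosed : (π : Permutation′ (k ℕ.+ m)) (α : Permutation′ k) (β : Permutation′ m) →
                 (∀ i → π ⟨$⟩ʳ i ≡ (α ⊕ β) i) → PrefixClosed (π ⟨$⟩ʳ_) k
⊕⇒prefixClosed {k} {m} π α β π≗α⊕β j j<k with toℕ<⇒↑ˡ j j<k
... | t , refl = subst (ℕ._< k) (sym (begin
  toℕ (π ⟨$⟩ʳ (t ↑ˡ m))   ≡⟨ cong toℕ (π≗α⊕β _) ⟩
  toℕ ((α ⊕ β) (t ↑ˡ m))  ≡⟨ cong toℕ (⊕-↑ˡ α β t) ⟩
  toℕ ((α ⟨$⟩ʳ t) ↑ˡ m)   ≡⟨ toℕ-↑ˡ _ m ⟩
  toℕ (α ⟨$⟩ʳ t)          ∎)) (toℕ<n _)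
  where open ≡-Reasoning

m<n⇒∃[o]m+suc[o]≡n : m ℕ.< n → ∃ λ o → m ℕ.+ suc o ≡ n
m<n⇒∃[o]m+suc[o]≡n {m} m<n = let o , e = ℕ.m≤n⇒∃[o]m+o≡n m<n in o , trans (ℕ.+-suc m o) e

indecomposable⇒¬prefixClosed : (π : Permutation′ n) → SumIndecomposable π →
                               0 ℕ.< k → k ℕ.< n → ¬ PrefixClosed (π ⟨$⟩ʳ_) k
indecomposable⇒¬prefixClosed {k = suc a} π indecomposable _ k<n closed
  with b , refl ← m<n⇒∃[o]m+suc[o]≡n k<n
  = let α , β , π≗α⊕β = prefixClosed⇒⊕ π closed in
    indecomposable (a , b , refl , α , β , λ i →
      subst₂ (λ x y → π ⟨$⟩ʳ x ≡ y) (sym (cast-is-id refl i)) (sym (cast-is-id refl _)) (π≗α⊕β i))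

¬prefixClosed⇒indecomposable : (π : Permutation′ (suc n)) →
  (∀ k → 0 ℕ.< k → k ℕ.< suc n → ¬ PrefixClosed (π ⟨$⟩ʳ_) k) → SumIndecomposable π
¬prefixClosed⇒indecomposable π noBlock (a , b , refl , α , β , π≗α⊕β) =
  noBlock (suc a) z<s (ℕ.m<m+n (suc a) z<s) (⊕⇒prefixClosed π α β λ i →
    subst₂ (λ x y → π ⟨$⟩ʳ x ≡ y) (cast-is-id refl i) (cast-is-id refl _) (π≗α⊕β i))

toℕ-punchIn-< : (i : Fin (suc n)) (j : Fin n) → toℕ j ℕ.< toℕ i → toℕ (punchIn i j) ≡ toℕ j
toℕ-punchIn-< (suc i) zero    _         = refl
toℕ-punchIn-< (suc i) (suc j) (s<s j<i) = cong suc (toℕ-punchIn-< i j j<i)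

toℕ-punchIn-≥ : (i : Fin (suc n)) (j : Fin n) → toℕ i ℕ.≤ toℕ j → toℕ (punchIn i j) ≡ suc (toℕ j)
toℕ-punchIn-≥ zero    j       _         = refl
toℕ-punchIn-≥ (suc i) (suc j) (s≤s i≤j) = cong suc (toℕ-punchIn-≥ i j i≤j)

toℕ-punchIn-≤ : (i : Fin (suc n)) (j : Fin n) → toℕ (punchIn i j) ℕ.≤ suc (toℕ j)
toℕ-punchIn-≤ zero    j       = ℕ.≤-refl
toℕ-punchIn-≤ (suc i) zero    = z≤n
toℕ-punchIn-≤ (suc i) (suc j) = s≤s (toℕ-punchIn-≤ i j)

punchIn-preimage-< : (i J : Fin (suc n)) → J < i → ∃ λ j → toℕ j ≡ toℕ J × punchIn i j ≡ J
punchIn-preimage-< {n} i J J<i = j , j≡J , toℕ-injective (begin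
  toℕ (punchIn i j)  ≡⟨ toℕ-punchIn-< i j (subst (ℕ._< toℕ i) (sym j≡J) J<i) ⟩
  toℕ j              ≡⟨ j≡J ⟩
  toℕ J              ∎)
  where
  open ≡-Reasoning
  J<n : toℕ J ℕ.< n
  J<n = ℕ.<-≤-trans J<i (ℕ.s≤s⁻¹ (toℕ<n i))
  j : Fin n
  j = fromℕ< J<n
  j≡J : toℕ j ≡ toℕ J
  j≡J = toℕ-fromℕ< J<n

punchIn-preimage-> : (i J : Fin (suc n)) → i < J → ∃ λ j → suc (toℕ j) ≡ toℕ J × punchIn i j ≡ J
punchIn-preimage-> i (suc j) i<J = j , refl , toℕ-injective (toℕ-punchIn-≥ i j (ℕ.s≤s⁻¹ i<J))

module _ (π : Permutation′ (suc n)) (i : Fin (suc n)) (j : Fin n) where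

  punchIn-permute-≤ : toℕ (π ⟨$⟩ʳ punchIn i j) ℕ.≤ suc (toℕ (remove i π ⟨$⟩ʳ j))
  punchIn-permute-≤ =
    subst (ℕ._≤ suc (toℕ (remove i π ⟨$⟩ʳ j))) (cong toℕ (sym (punchIn-permute π i j)))
      (toℕ-punchIn-≤ (π ⟨$⟩ʳ i) (remove i π ⟨$⟩ʳ j))

  punchIn-permute-< : toℕ (remove i π ⟨$⟩ʳ j) ℕ.< toℕ (π ⟨$⟩ʳ i) →
                      toℕ (π ⟨$⟩ʳ punchIn i j) ≡ toℕ (remove i π ⟨$⟩ʳ j)
  punchIn-permute-< σj<πi = trans (cong toℕ (punchIn-permute π i j))
    (toℕ-punchIn-< (π ⟨$⟩ʳ i) (remove i π ⟨$⟩ʳ j) σj<πi)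

module _ (π : Permutation′ (suc n)) (i : Fin (suc n)) {k}
         (closed : PrefixClosed (remove i π ⟨$⟩ʳ_) k) where

  remove-prefixClosed-≤ : ∀ j → toℕ j ℕ.< k → toℕ (π ⟨$⟩ʳ punchIn i j) ℕ.≤ k
  remove-prefixClosed-≤ j j<k = ℕ.≤-trans (punchIn-permute-≤ π i j) (closed j j<k)

  remove-prefixClosed⇒prefixClosed-suc : toℕ i ℕ.≤ k → toℕ (π ⟨$⟩ʳ i) ℕ.≤ k →
                                         PrefixClosed (π ⟨$⟩ʳ_) (suc k)
  remove-prefixClosed⇒prefixClosed-suc i≤k πi≤k J J≤k with ℕ.<-cmp (toℕ J) (toℕ i)
  ... | tri< J<i _ _ with j , j≡J , refl ← punchIn-preimage-< i J J<i =
    s≤s (remove-prefixClosed-≤ j (subst (ℕ._< k) (sym j≡J) (ℕ.<-≤-trans J<i i≤k)))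
  ... | tri≈ _ J≡i _ rewrite toℕ-injective J≡i = s≤s πi≤k
  ... | tri> _ _ i<J with j , 1+j≡J , refl ← punchIn-preimage-> i J i<J =
    s≤s (remove-prefixClosed-≤ j (subst (ℕ._≤ k) (sym 1+j≡J) (ℕ.s≤s⁻¹ J≤k)))

  module _ (k≤i : k ℕ.≤ toℕ i) where

    remove-prefixClosed-below-≤ : ∀ J → toℕ J ℕ.< k → toℕ (π ⟨$⟩ʳ J) ℕ.≤ k
    remove-prefixClosed-below-≤ J J<k
      with j , j≡J , refl ← punchIn-preimage-< i J (ℕ.<-≤-trans J<k k≤i) =
      remove-prefixClosed-≤ j (subst (ℕ._< k) (sym j≡J) J<k)

    remove-prefixClosed⇒prefixClosed : k ℕ.≤ toℕ (π ⟨$⟩ʳ i) → PrefixClosed (π ⟨$⟩ʳ_) k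
    remove-prefixClosed⇒prefixClosed k≤πi J J<k
      with j , j≡J , refl ← punchIn-preimage-< i J (ℕ.<-≤-trans J<k k≤i) =
      subst (ℕ._< k) (sym (punchIn-permute-< π i j (ℕ.<-≤-trans σj<k k≤πi))) σj<k
      where
      σj<k : toℕ (remove i π ⟨$⟩ʳ j) ℕ.< k
      σj<k = closed j (subst (ℕ._< k) (sym j≡J) J<k)

    remove-prefixClosed⇒small-unique : ∀ {j₁ j₂} → k ℕ.≤ toℕ j₁ → k ℕ.≤ toℕ j₂ →
      toℕ (π ⟨$⟩ʳ j₁) ℕ.< k → toℕ (π ⟨$⟩ʳ j₂) ℕ.< k → j₁ ≡ j₂
    remove-prefixClosed⇒small-unique {j₁} {j₂} k≤j₁ k≤j₂ πj₁<k πj₂<k with j₁ ≟ j₂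
    ... | yes j₁≡j₂ = j₁≡j₂
    ... | no  j₁≢j₂ = contradiction (bounded-injective⇒≤ ((π ⟨$⟩ʳ_) ∘ h) h-inj bound) ℕ.1+n≰n
      where
      -- j₁, j₂ and the first k positions would be k + 2 positions with values at most k.
      k≤1+n : k ℕ.≤ suc n
      k≤1+n = ℕ.≤-trans k≤i (ℕ.<⇒≤ (toℕ<n i))
      h : Fin (suc (suc k)) → Fin (suc n)
      h = j₁ ∷ j₂ ∷ λ t → inject≤ t k≤1+n
      h-inj : Injective _≡_ _≡_ ((π ⟨$⟩ʳ_) ∘ h)
      h-inj = ∷-injective (∷-injective (inject≤-injective _ _ _ _) (inject≤-≢ k≤1+n k≤j₂))
                (λ { zero eq → j₁≢j₂ (sym eq) ; (suc t) → inject≤-≢ k≤1+n k≤j₁ t })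
              ∘ ⟨$⟩ʳ-injective π
      bound : ∀ t → toℕ (π ⟨$⟩ʳ h t) ℕ.< suc k
      bound zero          = ℕ.m<n⇒m<1+n πj₁<k
      bound (suc zero)    = ℕ.m<n⇒m<1+n πj₂<k
      bound (suc (suc t)) = s≤s (remove-prefixClosed-below-≤ _ (inject≤-< k≤1+n t))

toℕ-⟨$⟩ʳ-posMax : (π : Permutation′ (suc m)) → ∀ {J} → J ≡ posMax π → toℕ (π ⟨$⟩ʳ J) ≡ m
toℕ-⟨$⟩ʳ-posMax {m} π refl = trans (cong toℕ (inverseʳ π)) (toℕ-fromℕ m)

suc-toℕ-pred : (J : Fin n) → 0 ℕ.< toℕ J → suc (toℕ (pred J)) ≡ toℕ J
suc-toℕ-pred (suc j) _ = cong suc (toℕ-inject₁ j)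

removeLeft-indecomposable : (π : Permutation′ (suc m)) → SumIndecomposable π →
  (i : Fin (suc m)) → i < posMax π →
  toℕ (π ⟨$⟩ʳ i) ℕ.≤ suc (toℕ i) ⊎ suc (toℕ i) ≡ toℕ (posMax π) →
  (∀ J → J < i → suc (toℕ J) ℕ.< toℕ (π ⟨$⟩ʳ J)) →
  SumIndecomposable (remove i π)
removeLeft-indecomposable {zero} π _ i i<p _ _ =
  ℕ.n≮0 (ℕ.<-≤-trans i<p (ℕ.s≤s⁻¹ (toℕ<n (posMax π))))
removeLeft-indecomposable {suc m} π indecomposable i i<p low-or-adjacent above =
  ¬prefixClosed⇒indecomposable (remove i π) noBlock
  where
  noBlock : ∀ k → 0 ℕ.< k → k ℕ.< suc m → ¬ PrefixClosed (remove i π ⟨$⟩ʳ_) k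
  noBlock (suc k) _ k<m closed with suc k ℕ.≤? toℕ i
  ... | yes k<i =
    ℕ.<⇒≱ (subst (λ x → suc x ℕ.< toℕ (π ⟨$⟩ʳ punchIn i j)) J≡k (above _ J<i))
          (remove-prefixClosed-≤ π i closed j (subst (ℕ._< suc k) (sym j≡k) (ℕ.n<1+n k)))
    where
    j : Fin (suc m)
    j = fromℕ< (ℕ.<-trans (ℕ.n<1+n k) k<m)
    j≡k : toℕ j ≡ k
    j≡k = toℕ-fromℕ< (ℕ.<-trans (ℕ.n<1+n k) k<m)
    J≡k : toℕ (punchIn i j) ≡ k
    J≡k = trans (toℕ-punchIn-< i j (subst (ℕ._< toℕ i) (sym j≡k) k<i)) j≡k
    J<i : punchIn i j < i
    J<i = subst (ℕ._< toℕ i) (sym J≡k) k<i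
  ... | no k≮i = [ low , adjacent ]′ low-or-adjacent
    where
    i<1+k : toℕ i ℕ.< suc k
    i<1+k = ℕ.≰⇒> k≮i
    low : toℕ (π ⟨$⟩ʳ i) ℕ.≤ suc (toℕ i) → ⊥
    low πi≤1+i = indecomposable⇒¬prefixClosed π indecomposable z<s (s<s k<m)
      (remove-prefixClosed⇒prefixClosed-suc π i closed (ℕ.<⇒≤ i<1+k) (ℕ.≤-trans πi≤1+i i<1+k))
    adjacent : suc (toℕ i) ≡ toℕ (posMax π) → ⊥
    adjacent 1+i≡p with j , 1+j≡p , j↦p ← punchIn-preimage-> i (posMax π) i<p =
      ℕ.<⇒≱ k<m (subst (ℕ._≤ suc k) (toℕ-⟨$⟩ʳ-posMax π j↦p)
        (remove-prefixClosed-≤ π i closed j j<1+k))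
      where
      j<1+k : toℕ j ℕ.< suc k
      j<1+k = subst (ℕ._< suc k) (ℕ.suc-injective (trans 1+i≡p (sym 1+j≡p))) i<1+k

leftDeletion : (π : Permutation′ (suc m)) → SumIndecomposable π →
  (Σ (Fin (suc m)) λ j → j < posMax π) →
  Σ (Fin (suc m)) λ i → (i < posMax π) × SumIndecomposable (remove i π)
leftDeletion {m} π indecomposable (j , j<p) =
  choose (¬∀⟶∃¬-smallest (suc m) P (λ J → suc (toℕ J) ℕ.<? toℕ (π ⟨$⟩ʳ J)) ¬∀P)
  where
  P : Fin (suc m) → Set
  P J = suc (toℕ J) ℕ.< toℕ (π ⟨$⟩ʳ J)
  ¬∀P : ¬ (∀ J → P J)
  ¬∀P ∀P = ℕ.<-asym (toℕ<n (π ⟨$⟩ʳ fromℕ m))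
    (subst (λ x → suc x ℕ.< toℕ (π ⟨$⟩ʳ fromℕ m)) (toℕ-fromℕ m) (∀P (fromℕ m)))
  below : ∀ {i′} → ((J : Fin′ i′) → P (inject J)) → ∀ J → J < i′ → P J
  below P-below J J<i′ = subst P J′≡J (P-below (fromℕ< J<i′))
    where
    J′≡J : inject (fromℕ< J<i′) ≡ J
    J′≡J = toℕ-injective (trans (toℕ-inject (fromℕ< J<i′)) (toℕ-fromℕ< J<i′))
  choose : (∃ λ i′ → ¬ P i′ × ((J : Fin′ i′) → P (inject J))) →
           Σ (Fin (suc m)) λ i → (i < posMax π) × SumIndecomposable (remove i π)
  choose (i′ , ¬Pi′ , P-below) with toℕ i′ ℕ.<? toℕ (posMax π)
  ... | yes i′<p = i′ , i′<p ,
    removeLeft-indecomposable π indecomposable i′ i′<p (inj₁ (ℕ.≮⇒≥ ¬Pi′)) (below P-below)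
  ... | no  i′≮p = pred (posMax π) , i<p ,
    removeLeft-indecomposable π indecomposable _ i<p (inj₂ 1+i≡p)
      (λ J J<i → below P-below J (ℕ.<-≤-trans (ℕ.<-trans J<i i<p) (ℕ.≮⇒≥ i′≮p)))
    where
    1+i≡p : suc (toℕ (pred (posMax π))) ≡ toℕ (posMax π)
    1+i≡p = suc-toℕ-pred (posMax π) (ℕ.≤-<-trans z≤n j<p)
    i<p : pred (posMax π) < posMax π
    i<p = subst (toℕ (pred (posMax π)) ℕ.<_) 1+i≡p ℕ.≤-refl

removeRight-indecomposable : (π : Permutation′ (suc m)) → SumIndecomposable π →
  (i : Fin (suc m)) → posMax π < i → ∀ {j₁ j₂} → posMax π < j₁ → j₁ < j₂ →
  toℕ (π ⟨$⟩ʳ j₁) ℕ.≤ toℕ (π ⟨$⟩ʳ i) → toℕ (π ⟨$⟩ʳ j₂) ℕ.≤ toℕ (π ⟨$⟩ʳ i) →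
  SumIndecomposable (remove i π)
removeRight-indecomposable {zero} π _ i p<i _ _ _ _ =
  ℕ.n≮0 (ℕ.<-≤-trans p<i (ℕ.s≤s⁻¹ (toℕ<n i)))
removeRight-indecomposable {suc m} π indecomposable i p<i {j₁} {j₂} p<j₁ j₁<j₂ πj₁≤πi πj₂≤πi =
  ¬prefixClosed⇒indecomposable (remove i π) noBlock
  where
  block≤p : ∀ {k} → k ℕ.< suc m → PrefixClosed (remove i π ⟨$⟩ʳ_) k → k ℕ.≤ toℕ (posMax π)
  block≤p {k} k<m closed = ℕ.≮⇒≥ λ p<k →
    let j , j≡p , j↦p = punchIn-preimage-< i (posMax π) p<i in
    ℕ.<⇒≱ k<m (subst (ℕ._≤ k) (toℕ-⟨$⟩ʳ-posMax π j↦p)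
      (remove-prefixClosed-≤ π i closed j (subst (ℕ._< k) (sym j≡p) p<k)))
  block≤right : ∀ {k J} → k ℕ.< suc m → PrefixClosed (remove i π ⟨$⟩ʳ_) k →
                posMax π < J → k ℕ.≤ toℕ J
  block≤right k<m closed p<J = ℕ.<⇒≤ (ℕ.≤-<-trans (block≤p k<m closed) p<J)
  noBlock : ∀ k → 0 ℕ.< k → k ℕ.< suc m → ¬ PrefixClosed (remove i π ⟨$⟩ʳ_) k
  noBlock k 0<k k<m closed with k ℕ.≤? toℕ (π ⟨$⟩ʳ i)
  ... | yes k≤πi = indecomposable⇒¬prefixClosed π indecomposable 0<k (ℕ.m<n⇒m<1+n k<m)
                     (remove-prefixClosed⇒prefixClosed π i closed (block≤right k<m closed p<i) k≤πi)
  ... | no  k≰πi = ℕ.<-irrefl (cong toℕ j₁≡j₂) j₁<j₂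
    where
    j₁≡j₂ : j₁ ≡ j₂
    j₁≡j₂ = remove-prefixClosed⇒small-unique π i closed (block≤right k<m closed p<i)
      (block≤right k<m closed p<j₁) (block≤right k<m closed (ℕ.<-trans p<j₁ j₁<j₂))
      (ℕ.≤-<-trans πj₁≤πi (ℕ.≰⇒> k≰πi)) (ℕ.≤-<-trans πj₂≤πi (ℕ.≰⇒> k≰πi))

rightDeletion : (π : Permutation′ (suc m)) → SumIndecomposable π →
  (Σ (Fin (suc m)) λ j → Σ (Fin (suc m)) λ k → (posMax π < j) × (j < k)) →
  Σ (Fin (suc m)) λ i → (posMax π < i) × SumIndecomposable (remove i π)
rightDeletion π indecomposable (j₁ , j₂ , p<j₁ , j₁<j₂) with toℕ (π ⟨$⟩ʳ j₁) ℕ.≤? toℕ (π ⟨$⟩ʳ j₂)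
... | yes πj₁≤πj₂ = j₂ , p<j₂ ,
  removeRight-indecomposable π indecomposable j₂ p<j₂ p<j₁ j₁<j₂ πj₁≤πj₂ ℕ.≤-refl
  where
  p<j₂ : posMax π < j₂
  p<j₂ = ℕ.<-trans p<j₁ j₁<j₂
... | no  πj₁≰πj₂ = j₁ , p<j₁ ,
  removeRight-indecomposable π indecomposable j₁ p<j₁ p<j₁ j₁<j₂ ℕ.≤-refl (ℕ.<⇒≤ (ℕ.≰⇒> πj₁≰πj₂))

proposition4p6 : (m : ℕ) (π : Permutation′ (suc m)) → SumIndecomposable π →
    ((Σ (Fin (suc m)) λ j → j < posMax π) →
      Σ (Fin (suc m)) λ i → (i < posMax π) × SumIndecomposable (deleteAt i π))
    × ((Σ (Fin (suc m)) λ j → Σ (Fin (suc m)) λ k → (posMax π < j) × (j < k)) →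
      Σ (Fin (suc m)) λ i → (posMax π < i) × SumIndecomposable (deleteAt i π))
proposition4p6 m π indecomposable = leftDeletion π indecomposable , rightDeletion π indecomposable
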